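{- Let $m$ and $n$ be positive integers with $m \equiv 5 \pmod{6}$ and $n = \left\lceil\tfrac{1}{3}\binom{m}{2}\right\rceil$. Then \[Z_{2,2}(m,n) \leqslant \left\lfloor \tfrac{1}{4}m(m-1)+\tfrac{3}{2}n \right\rfloor-1.\]
   Context: A hypergraph $H$ consists of a finite vertex set and a multiset of edges, each a nonempty subset of the vertex set. The total degree is the sum of the edge sizes. $H$ is linear if each pair of distinct vertices lies together in at most one edge. $Z_{2,2}(m,n)$ is the maximum total degree of a linear hypergraph with $m$ vertices and $n$ edges. -}

module Defs where

open import Data.Nat using (ℕ; _+_; _*_; _∸_; _≤_)
open import Data.Nat.DivMod using (_/_)
open import Data.Fin using (Fin)
open import Data.Fin.Subset using (Subset; _∈_; ∣_∣; Nonempty)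
open import Data.Vec using (tabulate; sum)
open import Relation.Binary.PropositionalEquality using (_≡_; _≢_)

-- A hypergraph with vertex set Fin m and a multiset of n edges,
-- given as an indexed family of edges (index = edge occurrence),
-- each edge a nonempty subset of the vertex set.
record Hypergraph (m n : ℕ) : Set where
  field
    edge     : Fin n → Subset m
    nonempty : ∀ i → Nonempty (edge i)

open Hypergraph public

totalDegree : ∀ {m n} → Hypergraph m n → ℕ
totalDegree {m} {n} H = sum (tabulate (λ i → ∣ edge H i ∣))

-- linear: each pair of distinct vertices lies together in at most one edge
-- (edges counted with multiplicity, i.e. by occurrence index)
IsLinear : ∀ {m n} → Hypergraph m n → Set
IsLinear {m} {n} H =
  ∀ (u v : Fin m) → u ≢ v → ∀ (i j : Fin n) →
  u ∈ edge H i → v ∈ edge H i → u ∈ edge H j → v ∈ edge H j → i ≡ j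

-- "Z_{2,2}(m,n) ≤ b": every linear hypergraph with m vertices and n edges
-- has total degree at most b (i.e. the maximum is at most b).
Z22≤ : ℕ → ℕ → ℕ → Set
Z22≤ m n b = ∀ (H : Hypergraph m n) → IsLinear H → totalDegree H ≤ b

⌈_/3⌉ : ℕ → ℕ
⌈ k /3⌉ = (k + 2) / 3

choose2 : ℕ → ℕ
choose2 m = (m * (m ∸ 1)) / 2

{-# OPTIONS --safe #-}

-- Write T for the total degree and Q for the sum of the squared edge sizes.
-- Linearity makes the edges through a vertex v disjoint away from v, so
-- Σ_{e ∋ v} (|e| - 1) ≤ m - 1; summing over v gives Q ≤ T + m(m-1).
-- Together with s² + 6 ≥ 5s (i.e. (s-2)(s-3) ≥ 0) this yields 4T ≤ m(m-1) + 6n.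
-- For m = 6k+5 and n = ⌈m(m-1)/6⌉ we have m(m-1) + 4 = 6n, so T ≥ 3n - 1
-- would make every inequality above an equality: all edges have size 2 or 3,
-- exactly one of size 2, and every vertex v has Σ_{e ∋ v} (|e| - 1) = m - 1.
-- At a vertex of the edge of size 2 the left-hand side is odd, while m - 1 is even.

module Submission where

open import Defs
open import Data.Nat using (ℕ; _+_; _*_; _∸_)
open import Data.Nat.DivMod using (_/_; _%_)
open import Relation.Binary.PropositionalEquality using (_≡_)

open import Data.Nat using (zero; suc; _≤_; _<_; _≤?_; z≤n; s≤s; z<s)
open import Data.Nat.Properties
open import Data.Nat.DivMod using (m*n/n≡m; m≡m%n+[m/n]*n)
open import Data.Nat.Tactic.RingSolver using (solve-∀)
open import Algebra.Properties.Semiring.Sum +-*-semiring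
  using (sum; sum-cong-≗; ∑-comm; ∑-distrib-+; *-distribˡ-sum; *-distribʳ-sum; sum-remove)
open import Data.Bool using (true; false; if_then_else_)
open import Data.Fin using (Fin; zero; suc; punchIn)
open import Data.Fin.Properties using (punchInᵢ≢i) renaming (suc-injective to Fin-suc-injective)
open import Data.Fin.Subset using (Subset; _∈_; ∣_∣)
open import Data.Vec using ([]; _∷_; lookup; tabulate)
import Data.Vec as Vec
open import Data.Vec.Properties using ([]=⇒lookup; lookup⇒[]=)
open import Data.Product using (∃; _×_; _,_; proj₁; proj₂)
open import Data.Sum using (inj₁; inj₂)
open import Function using (_∘_)
open import Relation.Binary.PropositionalEquality
  using (_≢_; refl; sym; trans; cong; cong₂; subst; module ≡-Reasoning)
open import Relation.Nullary using (yes; no; contradiction)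

sum-tabulate : ∀ {n} (f : Fin n → ℕ) → Vec.sum (tabulate f) ≡ sum f
sum-tabulate {zero}  f = refl
sum-tabulate {suc n} f = cong (f zero +_) (sum-tabulate (f ∘ suc))

sum-const : ∀ n c → sum {n} (λ _ → c) ≡ n * c
sum-const zero    c = refl
sum-const (suc n) c = cong (c +_) (sum-const n c)

sum-mono-≤ : ∀ {n} {f g : Fin n → ℕ} → (∀ i → f i ≤ g i) → sum f ≤ sum g
sum-mono-≤ {zero}  f≤g = z≤n
sum-mono-≤ {suc n} f≤g = +-mono-≤ (f≤g zero) (sum-mono-≤ (f≤g ∘ suc))

sum-mono-< : ∀ {n} {f g : Fin n → ℕ} → (∀ i → f i ≤ g i) → ∀ i → f i < g i → sum f < sum g
sum-mono-< f≤g zero    fᵢ<gᵢ = +-mono-<-≤ fᵢ<gᵢ (sum-mono-≤ (f≤g ∘ suc))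
sum-mono-< f≤g (suc i) fᵢ<gᵢ = +-mono-≤-< (f≤g zero) (sum-mono-< (f≤g ∘ suc) i fᵢ<gᵢ)

sum-mono-≤-tight : ∀ {n} {f g : Fin n → ℕ} → (∀ i → f i ≤ g i) → sum g ≤ sum f →
                   ∀ i → f i ≡ g i
sum-mono-≤-tight f≤g Σg≤Σf i with m≤n⇒m<n∨m≡n (f≤g i)
... | inj₁ fᵢ<gᵢ = contradiction (sum-mono-< f≤g i fᵢ<gᵢ) (≤⇒≯ Σg≤Σf)
... | inj₂ fᵢ≡gᵢ = fᵢ≡gᵢ

term≤sum : ∀ {n} (f : Fin n → ℕ) i → f i ≤ sum f
term≤sum f zero    = m≤m+n (f zero) _
term≤sum f (suc i) = ≤-trans (term≤sum (f ∘ suc) i) (m≤n+m _ (f zero))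

sum-positive : ∀ {n} (f : Fin n → ℕ) → 0 < sum f → ∃ λ i → 0 < f i
sum-positive {suc n} f pos with f zero in f₀≡
... | suc _ = zero , subst (0 <_) (sym f₀≡) z<s
... | zero  = let i , fᵢ>0 = sum-positive (f ∘ suc) pos in suc i , fᵢ>0

sum-≤1 : ∀ {n} (f : Fin n → ℕ) → (∀ i → f i ≤ 1) →
         (∀ i j → 0 < f i → 0 < f j → i ≡ j) → sum f ≤ 1
sum-≤1 {zero}  f f≤1 unique = z≤n
sum-≤1 {suc n} f f≤1 unique with 0 <? f zero
... | no  f₀≯0 = +-mono-≤ (≮⇒≥ f₀≯0)
                   (sum-≤1 (f ∘ suc) (f≤1 ∘ suc) (λ i j p q → Fin-suc-injective (unique (suc i) (suc j) p q)))
... | yes f₀>0 = +-mono-≤ (f≤1 zero) (begin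
    sum (f ∘ suc)       ≤⟨ sum-mono-≤ (λ j → ≮⇒≥ (λ fⱼ>0 → contradiction (unique zero (suc j) f₀>0 fⱼ>0) λ ())) ⟩
    sum {n} (λ _ → 0)   ≡⟨ sum-const n 0 ⟩
    n * 0               ≡⟨ *-zeroʳ n ⟩
    0                   ∎)
  where open ≤-Reasoning

sum-≤-pivot : ∀ {m} (t : Fin (suc m) → ℕ) v → (∀ u → u ≢ v → t u ≤ 1) → sum t ≤ t v + m
sum-≤-pivot {m} t v off≤1 = begin
  sum t                       ≡⟨ sum-remove {i = v} t ⟩
  t v + sum (t ∘ punchIn v)   ≤⟨ +-monoʳ-≤ (t v) (sum-mono-≤ (λ j → off≤1 (punchIn v j) (punchInᵢ≢i v j))) ⟩
  t v + sum {m} (λ _ → 1)     ≡⟨ cong (t v +_) (trans (sum-const m 1) (*-identityʳ m)) ⟩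
  t v + m                     ∎
  where open ≤-Reasoning

indicator : ∀ {m} → Subset m → Fin m → ℕ
indicator p x = if lookup p x then 1 else 0

indicator≤1 : ∀ {m} (p : Subset m) x → indicator p x ≤ 1
indicator≤1 p x with lookup p x
... | true  = ≤-refl
... | false = z≤n

indicator-idem : ∀ {m} (p : Subset m) x → indicator p x * indicator p x ≡ indicator p x
indicator-idem p x with lookup p x
... | true  = refl
... | false = refl

∈⇒indicator≡1 : ∀ {m} {p : Subset m} {x} → x ∈ p → indicator p x ≡ 1
∈⇒indicator≡1 x∈p = cong (λ b → if b then 1 else 0) ([]=⇒lookup x∈p)

indicator-product>0⇒∈ : ∀ {m} (p : Subset m) u v →
                        0 < indicator p u * indicator p v → u ∈ p × v ∈ p
indicator-product>0⇒∈ p u v pos with lookup p u in pᵤ | lookup p v in pᵥ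
indicator-product>0⇒∈ p u v pos | true  | true  = lookup⇒[]= u p pᵤ , lookup⇒[]= v p pᵥ
indicator-product>0⇒∈ p u v ()  | true  | false
indicator-product>0⇒∈ p u v ()  | false | _

sum-indicator : ∀ {m} (p : Subset m) → sum (indicator p) ≡ ∣ p ∣
sum-indicator []          = refl
sum-indicator (true ∷ p)  = cong suc (sum-indicator p)
sum-indicator (false ∷ p) = sum-indicator p

module _ {m n} (H : Hypergraph m n) where

  size : Fin n → ℕ
  size i = ∣ edge H i ∣

  Σsize Σsize² : ℕ
  Σsize  = sum size
  Σsize² = sum (λ i → size i * size i)

  incidence : Fin n → Fin m → ℕ
  incidence i = indicator (edge H i)

  degree : Fin m → ℕ
  degree v = sum (λ i → incidence i v)

  codegree : Fin m → Fin m → ℕ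
  codegree u v = sum (λ i → incidence i u * incidence i v)

  link : Fin m → ℕ
  link v = sum (λ i → incidence i v * size i)

  sum-degree : sum degree ≡ Σsize
  sum-degree = trans (∑-comm (λ v i → incidence i v)) (sum-cong-≗ (λ i → sum-indicator (edge H i)))

  sum-codegree : ∀ v → sum (λ u → codegree u v) ≡ link v
  sum-codegree v = begin
    sum (λ u → sum (λ i → incidence i u * incidence i v)) ≡⟨ ∑-comm (λ u i → incidence i u * incidence i v) ⟩
    sum (λ i → sum (λ u → incidence i u * incidence i v)) ≡⟨ sum-cong-≗ (λ i → *-distribʳ-sum (incidence i v) (incidence i)) ⟨
    sum (λ i → sum (incidence i) * incidence i v)         ≡⟨ sum-cong-≗ (λ i → cong (_* incidence i v) (sum-indicator (edge H i))) ⟩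
    sum (λ i → size i * incidence i v)                    ≡⟨ sum-cong-≗ (λ i → *-comm (size i) (incidence i v)) ⟩
    link v                                                ∎
    where open ≡-Reasoning

  sum-link : sum link ≡ Σsize²
  sum-link = begin
    sum (λ v → sum (λ i → incidence i v * size i)) ≡⟨ ∑-comm (λ v i → incidence i v * size i) ⟩
    sum (λ i → sum (λ v → incidence i v * size i)) ≡⟨ sum-cong-≗ (λ i → *-distribʳ-sum (size i) (incidence i)) ⟨
    sum (λ i → sum (incidence i) * size i)         ≡⟨ sum-cong-≗ (λ i → cong (_* size i) (sum-indicator (edge H i))) ⟩
    Σsize²                                         ∎
    where open ≡-Reasoning

  codegree-diagonal : ∀ v → codegree v v ≡ degree v
  codegree-diagonal v = sum-cong-≗ (λ i → indicator-idem (edge H i) v)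

  codegree≤1 : IsLinear H → ∀ {u v} → u ≢ v → codegree u v ≤ 1
  codegree≤1 linear {u} {v} u≢v =
    sum-≤1 (λ i → incidence i u * incidence i v)
           (λ i → *-mono-≤ (indicator≤1 (edge H i) u) (indicator≤1 (edge H i) v))
           (λ i j pᵢ pⱼ → let u∈eᵢ , v∈eᵢ = indicator-product>0⇒∈ (edge H i) u v pᵢ
                              u∈eⱼ , v∈eⱼ = indicator-product>0⇒∈ (edge H j) u v pⱼ
                          in linear u v u≢v i j u∈eᵢ v∈eᵢ u∈eⱼ v∈eⱼ)

  sum-5s : sum (λ i → 5 * size i) ≡ 5 * Σsize
  sum-5s = sym (*-distribˡ-sum 5 size)

  sum-s²+6 : sum (λ i → size i * size i + 6) ≡ Σsize² + 6 * n
  sum-s²+6 = trans (∑-distrib-+ (λ i → size i * size i) (λ _ → 6))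
                   (cong (Σsize² +_) (trans (sum-const n 6) (*-comm n 6)))

5s<s²+6 : ∀ {s} → 3 < s → 5 * s < s * s + 6
5s<s²+6 {suc (suc (suc (suc t)))} (s≤s (s≤s (s≤s (s≤s _)))) =
  subst (5 * (4 + t) <_) (sym (gap t)) (m<m+n (5 * (4 + t)) z<s)
  where
  gap : ∀ t → (4 + t) * (4 + t) + 6 ≡ 5 * (4 + t) + suc (1 + 3 * t + t * t)
  gap = solve-∀

5s≤s²+6 : ∀ s → 5 * s ≤ s * s + 6
5s≤s²+6 0 = z≤n
5s≤s²+6 1 = m≤m+n 5 2
5s≤s²+6 2 = ≤-refl
5s≤s²+6 3 = ≤-refl
5s≤s²+6 (suc (suc (suc (suc t)))) = <⇒≤ (5s<s²+6 (m≤m+n 4 t))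

5s≡s²+6⇒s≤3 : ∀ s → 5 * s ≡ s * s + 6 → s ≤ 3
5s≡s²+6⇒s≤3 s eq = ≮⇒≥ (λ 3<s → <⇒≢ (5s<s²+6 3<s) eq)

5Σsize≤Σsize²+6n : ∀ {m n} (H : Hypergraph m n) → 5 * Σsize H ≤ Σsize² H + 6 * n
5Σsize≤Σsize²+6n {n = n} H = begin
  5 * Σsize H                          ≡⟨ sum-5s H ⟨
  sum (λ i → 5 * size H i)             ≤⟨ sum-mono-≤ (λ i → 5s≤s²+6 (size H i)) ⟩
  sum (λ i → size H i * size H i + 6)  ≡⟨ sum-s²+6 H ⟩
  Σsize² H + 6 * n                     ∎
  where open ≤-Reasoning

4T≡M+6n∧1+T≡3n : ∀ T M n → M + 4 ≡ 6 * n → 3 * n ≤ suc T → 4 * T ≤ M + 6 * n →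
                 4 * T ≡ M + 6 * n × suc T ≡ 3 * n
4T≡M+6n∧1+T≡3n T M n M+4≡6n 3n≤1+T 4T≤M+6n = 4T≡M+6n , 1+T≡3n
  where
  4+M+6n≡4[3n] : 4 + (M + 6 * n) ≡ 4 * (3 * n)
  4+M+6n≡4[3n] = begin
    4 + (M + 6 * n)  ≡⟨ regroup M n ⟩
    (M + 4) + 6 * n  ≡⟨ cong (_+ 6 * n) M+4≡6n ⟩
    6 * n + 6 * n    ≡⟨ twice n ⟩
    4 * (3 * n)      ∎
    where
    open ≡-Reasoning
    regroup : ∀ M n → 4 + (M + 6 * n) ≡ (M + 4) + 6 * n
    regroup = solve-∀
    twice : ∀ n → 6 * n + 6 * n ≡ 4 * (3 * n)
    twice = solve-∀

  M+6n≤4T : M + 6 * n ≤ 4 * T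
  M+6n≤4T = +-cancelˡ-≤ 4 _ _ (begin
    4 + (M + 6 * n)  ≡⟨ 4+M+6n≡4[3n] ⟩
    4 * (3 * n)      ≤⟨ *-monoʳ-≤ 4 3n≤1+T ⟩
    4 * suc T        ≡⟨ *-suc 4 T ⟩
    4 + 4 * T        ∎)
    where open ≤-Reasoning

  4T≡M+6n : 4 * T ≡ M + 6 * n
  4T≡M+6n = ≤-antisym 4T≤M+6n M+6n≤4T

  1+T≡3n : suc T ≡ 3 * n
  1+T≡3n = *-cancelˡ-≡ (suc T) (3 * n) 4 (trans (*-suc 4 T) (trans (cong (4 +_) 4T≡M+6n) 4+M+6n≡4[3n]))

-- The vertex set is Fin (suc m), so m here is the paper's m - 1.
module _ {m n} (H : Hypergraph (suc m) n) (linear : IsLinear H) where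

  link-bound : ∀ v → link H v ≤ degree H v + m
  link-bound v = begin
    link H v                   ≡⟨ sum-codegree H v ⟨
    sum (λ u → codegree H u v) ≤⟨ sum-≤-pivot (λ u → codegree H u v) v (λ u u≢v → codegree≤1 H linear u≢v) ⟩
    codegree H v v + m         ≡⟨ cong (_+ m) (codegree-diagonal H v) ⟩
    degree H v + m             ∎
    where open ≤-Reasoning

  sum-degree+m : sum (λ v → degree H v + m) ≡ Σsize H + suc m * m
  sum-degree+m = trans (∑-distrib-+ (degree H) (λ _ → m)) (cong₂ _+_ (sum-degree H) (sum-const (suc m) m))

  Σsize²≤Σsize+[1+m]m : Σsize² H ≤ Σsize H + suc m * m
  Σsize²≤Σsize+[1+m]m = begin
    Σsize² H                    ≡⟨ sum-link H ⟨
    sum (link H)                ≤⟨ sum-mono-≤ link-bound ⟩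
    sum (λ v → degree H v + m)  ≡⟨ sum-degree+m ⟩
    Σsize H + suc m * m         ∎
    where open ≤-Reasoning

  4Σsize≤[1+m]m+6n : 4 * Σsize H ≤ suc m * m + 6 * n
  4Σsize≤[1+m]m+6n = +-cancelˡ-≤ (Σsize H) _ _ (begin
    5 * Σsize H                       ≤⟨ 5Σsize≤Σsize²+6n H ⟩
    Σsize² H + 6 * n                  ≤⟨ +-monoˡ-≤ (6 * n) Σsize²≤Σsize+[1+m]m ⟩
    Σsize H + suc m * m + 6 * n       ≡⟨ +-assoc (Σsize H) (suc m * m) (6 * n) ⟩
    Σsize H + (suc m * m + 6 * n)     ∎)
    where open ≤-Reasoning

  module Tight (tight : 4 * Σsize H ≡ suc m * m + 6 * n) where

    Σsize+[1+m]m+6n≡5Σsize : Σsize H + suc m * m + 6 * n ≡ 5 * Σsize H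
    Σsize+[1+m]m+6n≡5Σsize = trans (+-assoc (Σsize H) (suc m * m) (6 * n)) (cong (Σsize H +_) (sym tight))

    Σsize²+6n≡5Σsize : Σsize² H + 6 * n ≡ 5 * Σsize H
    Σsize²+6n≡5Σsize = ≤-antisym
      (≤-trans (+-monoˡ-≤ (6 * n) Σsize²≤Σsize+[1+m]m) (≤-reflexive Σsize+[1+m]m+6n≡5Σsize))
      (5Σsize≤Σsize²+6n H)

    size≤3 : ∀ i → size H i ≤ 3
    size≤3 i = 5s≡s²+6⇒s≤3 (size H i)
      (sum-mono-≤-tight (λ j → 5s≤s²+6 (size H j))
                        (≤-reflexive (trans (sum-s²+6 H) (trans Σsize²+6n≡5Σsize (sym (sum-5s H))))) i)

    link-tight : ∀ v → link H v ≡ degree H v + m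
    link-tight = sum-mono-≤-tight link-bound (≤-reflexive (begin
      sum (λ v → degree H v + m) ≡⟨ sum-degree+m ⟩
      Σsize H + suc m * m        ≡⟨ +-cancelʳ-≡ (6 * n) _ _ (trans Σsize+[1+m]m+6n≡5Σsize (sym Σsize²+6n≡5Σsize)) ⟩
      Σsize² H                   ≡⟨ sum-link H ⟨
      sum (link H)               ∎))
      where open ≡-Reasoning

    deficiency : Fin n → ℕ
    deficiency i = 3 ∸ size H i

    size+deficiency : ∀ i → size H i + deficiency i ≡ 3
    size+deficiency i = m+[n∸m]≡n (size≤3 i)

    Σsize+sum-deficiency : Σsize H + sum deficiency ≡ 3 * n
    Σsize+sum-deficiency = begin
      Σsize H + sum deficiency                ≡⟨ ∑-distrib-+ (size H) deficiency ⟨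
      sum (λ i → size H i + deficiency i)     ≡⟨ sum-cong-≗ size+deficiency ⟩
      sum {n} (λ _ → 3)                       ≡⟨ sum-const n 3 ⟩
      n * 3                                   ≡⟨ *-comm n 3 ⟩
      3 * n                                   ∎
      where open ≡-Reasoning

    local-deficiency : Fin (suc m) → ℕ
    local-deficiency v = sum (λ i → incidence H i v * deficiency i)

    link+local-deficiency : ∀ v → link H v + local-deficiency v ≡ 3 * degree H v
    link+local-deficiency v = begin
      link H v + local-deficiency v
        ≡⟨ ∑-distrib-+ (λ i → incidence H i v * size H i) (λ i → incidence H i v * deficiency i) ⟨
      sum (λ i → incidence H i v * size H i + incidence H i v * deficiency i)
        ≡⟨ sum-cong-≗ (λ i → trans (sym (*-distribˡ-+ (incidence H i v) (size H i) (deficiency i)))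
                                    (cong (incidence H i v *_) (size+deficiency i))) ⟩
      sum (λ i → incidence H i v * 3)
        ≡⟨ *-distribʳ-sum 3 (λ i → incidence H i v) ⟨
      degree H v * 3
        ≡⟨ *-comm (degree H v) 3 ⟩
      3 * degree H v
        ∎
      where open ≡-Reasoning

    local-deficiency≤sum-deficiency : ∀ v → local-deficiency v ≤ sum deficiency
    local-deficiency≤sum-deficiency v = sum-mono-≤ (λ i → begin
      incidence H i v * deficiency i  ≤⟨ *-monoˡ-≤ (deficiency i) (indicator≤1 (edge H i) v) ⟩
      1 * deficiency i                ≡⟨ *-identityˡ (deficiency i) ⟩
      deficiency i                    ∎)
      where open ≤-Reasoning

    deficiency≤local-deficiency : ∀ {v i} → v ∈ edge H i → deficiency i ≤ local-deficiency v
    deficiency≤local-deficiency {v} {i} v∈eᵢ = begin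
      deficiency i                    ≡⟨ *-identityˡ (deficiency i) ⟨
      1 * deficiency i                ≡⟨ cong (_* deficiency i) (∈⇒indicator≡1 v∈eᵢ) ⟨
      incidence H i v * deficiency i  ≤⟨ term≤sum (λ j → incidence H j v * deficiency j) i ⟩
      local-deficiency v              ∎
      where open ≤-Reasoning

    one-short⇒m+1-even : suc (Σsize H) ≡ 3 * n → ∃ λ d → suc m ≡ 2 * d
    one-short⇒m+1-even 1+Σsize≡3n = degree H x , +-cancelˡ-≡ (degree H x) _ _ (begin
      degree H x + suc m            ≡⟨ +-suc (degree H x) m ⟩
      suc (degree H x + m)          ≡⟨ cong suc (link-tight x) ⟨
      suc (link H x)                ≡⟨ +-comm 1 (link H x) ⟩
      link H x + 1                  ≡⟨ cong (link H x +_) local-deficiency≡1 ⟨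
      link H x + local-deficiency x ≡⟨ link+local-deficiency x ⟩
      3 * degree H x                ∎)
      where
      open ≡-Reasoning

      sum-deficiency≡1 : sum deficiency ≡ 1
      sum-deficiency≡1 = +-cancelˡ-≡ (Σsize H) _ _
        (trans Σsize+sum-deficiency (trans (sym 1+Σsize≡3n) (+-comm 1 (Σsize H))))

      short-edge : ∃ λ i → 0 < deficiency i
      short-edge = sum-positive deficiency (subst (0 <_) (sym sum-deficiency≡1) z<s)

      i : Fin n
      i = proj₁ short-edge

      x : Fin (suc m)
      x = proj₁ (nonempty H i)

      local-deficiency≡1 : local-deficiency x ≡ 1
      local-deficiency≡1 = ≤-antisym
        (≤-trans (local-deficiency≤sum-deficiency x) (≤-reflexive sum-deficiency≡1))
        (≤-trans (proj₂ short-edge) (deficiency≤local-deficiency (proj₂ (nonempty H i))))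

  2+Σsize≤3n : ∀ b → m ≡ 2 * b → suc m * m + 4 ≡ 6 * n → 2 + Σsize H ≤ 3 * n
  2+Σsize≤3n b m≡2b [1+m]m+4≡6n with 2 + Σsize H ≤? 3 * n
  ... | yes 2+Σsize≤3n = 2+Σsize≤3n
  ... | no  2+Σsize≰3n =
    let tight , 1+Σsize≡3n = 4T≡M+6n∧1+T≡3n (Σsize H) (suc m * m) n [1+m]m+4≡6n (≤-pred (≰⇒> 2+Σsize≰3n)) 4Σsize≤[1+m]m+6n
        d , m+1≡2d = Tight.one-short⇒m+1-even tight 1+Σsize≡3n
    in  contradiction (trans (sym m+1≡2d) (cong suc m≡2b)) (even≢odd d b)

choose2-6k+5 : ∀ k → choose2 (5 + k * 6) ≡ 10 + k * 27 + k * k * 18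
choose2-6k+5 k = trans (cong (_/ 2) (m[m-1]≡ k)) (m*n/n≡m (10 + k * 27 + k * k * 18) 2)
  where
  m[m-1]≡ : ∀ k → (5 + k * 6) * (4 + k * 6) ≡ (10 + k * 27 + k * k * 18) * 2
  m[m-1]≡ = solve-∀

edges-6k+5 : ∀ k → ⌈ choose2 (5 + k * 6) /3⌉ ≡ 4 + k * 9 + k * k * 6
edges-6k+5 k = begin
  (choose2 (5 + k * 6) + 2) / 3          ≡⟨ cong (λ c → (c + 2) / 3) (choose2-6k+5 k) ⟩
  (10 + k * 27 + k * k * 18 + 2) / 3     ≡⟨ cong (_/ 3) (C+2≡ k) ⟩
  (4 + k * 9 + k * k * 6) * 3 / 3        ≡⟨ m*n/n≡m (4 + k * 9 + k * k * 6) 3 ⟩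
  4 + k * 9 + k * k * 6                  ∎
  where
  open ≡-Reasoning
  C+2≡ : ∀ k → 10 + k * 27 + k * k * 18 + 2 ≡ (4 + k * 9 + k * k * 6) * 3
  C+2≡ = solve-∀

bound-6k+5 : ∀ k → ((5 + k * 6) * ((5 + k * 6) ∸ 1) + 6 * (4 + k * 9 + k * k * 6)) / 4 ∸ 1
                   ≡ 10 + k * 27 + k * k * 18
bound-6k+5 k = cong (_∸ 1) (trans (cong (_/ 4) (numerator≡ k)) (m*n/n≡m (11 + k * 27 + k * k * 18) 4))
  where
  numerator≡ : ∀ k → (5 + k * 6) * (4 + k * 6) + 6 * (4 + k * 9 + k * k * 6)
                     ≡ (11 + k * 27 + k * k * 18) * 4
  numerator≡ = solve-∀

Z22≤-6k+5 : ∀ k → Z22≤ (5 + k * 6) (4 + k * 9 + k * k * 6) (10 + k * 27 + k * k * 18)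
Z22≤-6k+5 k H linear = begin
  totalDegree H              ≡⟨ sum-tabulate (size H) ⟩
  Σsize H                    ≤⟨ +-cancelˡ-≤ 2 _ _ (subst (2 + Σsize H ≤_) (3n≡ k)
                                  (2+Σsize≤3n H linear (2 + k * 3) (m-1≡ k) (m[m-1]+4≡ k))) ⟩
  10 + k * 27 + k * k * 18   ∎
  where
  open ≤-Reasoning
  m-1≡ : ∀ k → 4 + k * 6 ≡ 2 * (2 + k * 3)
  m-1≡ = solve-∀
  m[m-1]+4≡ : ∀ k → (5 + k * 6) * (4 + k * 6) + 4 ≡ 6 * (4 + k * 9 + k * k * 6)
  m[m-1]+4≡ = solve-∀
  3n≡ : ∀ k → 3 * (4 + k * 9 + k * k * 6) ≡ 2 + (10 + k * 27 + k * k * 18)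
  3n≡ = solve-∀

lemma2p6 : ∀ (m n : ℕ) → m % 6 ≡ 5 → n ≡ ⌈ choose2 m /3⌉ →
    Z22≤ m n (((m * (m ∸ 1) + 6 * n) / 4) ∸ 1)
lemma2p6 m n m%6≡5 refl = subst Claim (sym m≡5+6k) (claim (m / 6))
  where
  Claim : ℕ → Set
  Claim m = Z22≤ m ⌈ choose2 m /3⌉ ((m * (m ∸ 1) + 6 * ⌈ choose2 m /3⌉) / 4 ∸ 1)

  claim : ∀ k → Claim (5 + k * 6)
  claim k = subst (λ n → Z22≤ (5 + k * 6) n (((5 + k * 6) * (4 + k * 6) + 6 * n) / 4 ∸ 1))
                  (sym (edges-6k+5 k))
                  (subst (Z22≤ (5 + k * 6) (4 + k * 9 + k * k * 6)) (sym (bound-6k+5 k)) (Z22≤-6k+5 k))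

  m≡5+6k : m ≡ 5 + m / 6 * 6
  m≡5+6k = trans (m≡m%n+[m/n]*n m 6) (cong (_+ m / 6 * 6) m%6≡5)
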